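{- Let $A$ be a nonrecursive c.e. $D$-maximal set of Type 3. Then there exists an infinite noncomputable c.e. set $K\subseteq\overline A$ such that for every set $B\equiv_{\rm m}A$, every many-one reduction $h\colon A\le_{\rm m}B$ and every many-one reduction $f\colon B\le_{\rm m}A$: (1) $f^{ -1}(K)$ is infinite; and (2) $D_h\setminus(\operatorname{rng}(f)\cup K)$ is finite.
   Context: All sets are subsets of $\omega$; $\overline X=\omega\setminus X$; $X\subseteq^*Y$ means $X\setminus Y$ finite. $A\le_{\rm m}B$ via total computable $h$ means $x\in A\iff h(x)\in B$ for all $x$; $\equiv_{\rm m}$ is mutual $\le_{\rm m}$. For $h\colon A\le_{\rm m}B$, $D_h:=\{x\in\overline A:(\exists y<x)[\,y\in\overline A\text{ and }h(y)=h(x)\,]\}$; $\operatorname{rng}(f)$ is the range of $f$. A noncomputable c.e. set $A$ is $D$-maximal if for every c.e. $W\supseteq A$, either $W\setminus A$ is c.e. or there is a computable $R$ with $A\subseteq R\subseteq W$. For a c.e. set $A$, $\mathcal D(A)$ is the family of c.e. sets disjoint from $A$; a finite or countable family $\{G_i:i\in I\}$ of c.e. sets disjoint from $A$ generates $\mathcal D(A)$ if every c.e. $D$ disjoint from $A$ satisfies $D\subseteq^*\bigcup_{i\in F}G_i$ for some finite $F\subseteq I$. A generating family is of Type 1 if it is $\{\varnothing\}$, of Type 2 if it is $\{R\}$ with $R$ infinite computable, of Type 3 if it is $\{W\}$ with $W$ an infinite noncomputable c.e. set. $A$ is of Type 3 if $\mathcal D(A)$ has a generating family of Type 3 but none of Type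 1 or 2. -}

module Defs where

open import Data.Nat using (ℕ; zero; suc; _<_)
open import Data.Fin using (Fin)
open import Data.Vec using (Vec; []; _∷_; lookup)
open import Data.Product using (Σ; ∃; _×_; _,_)
open import Data.Sum using (_⊎_)
open import Data.Empty using (⊥)
open import Relation.Nullary using (¬_)
open import Relation.Binary.PropositionalEquality using (_≡_)
open import Function.Bundles using (_⇔_)

data Code : ℕ → Set where
  zer  : ∀ {n} → Code n
  succ : Code 1
  proj : ∀ {n} → Fin n → Code n
  comp : ∀ {m n} → Code m → Vec (Code n) m → Code n
  prec : ∀ {n} → Code n → Code (suc (suc n)) → Code (suc n)
  mu   : ∀ {n} → Code (suc n) → Code n

mutual
  data Eval : ∀ {n} → Code n → Vec ℕ n → ℕ → Set where
    ev-zer  : ∀ {n} {xs : Vec ℕ n} → Eval zer xs 0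
    ev-succ : ∀ {x} → Eval succ (x ∷ []) (suc x)
    ev-proj : ∀ {n} {i : Fin n} {xs} → Eval (proj i) xs (lookup xs i)
    ev-comp : ∀ {m n} {f : Code m} {gs : Vec (Code n) m} {xs ys y} →
              EvalAll gs xs ys → Eval f ys y → Eval (comp f gs) xs y
    ev-prec-z : ∀ {n} {f : Code n} {g xs y} →
                Eval f xs y → Eval (prec f g) (0 ∷ xs) y
    ev-prec-s : ∀ {n} {f : Code n} {g k xs r y} →
                Eval (prec f g) (k ∷ xs) r →
                Eval g (k ∷ r ∷ xs) y → Eval (prec f g) (suc k ∷ xs) y
    ev-mu   : ∀ {n} {f : Code (suc n)} {xs y} →
              Eval f (y ∷ xs) 0 →
              (∀ z → z < y → Σ ℕ λ k → Eval f (z ∷ xs) (suc k)) →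
              Eval (mu f) xs y

  data EvalAll : ∀ {m n} → Vec (Code n) m → Vec ℕ n → Vec ℕ m → Set where
    ev-[] : ∀ {n} {xs : Vec ℕ n} → EvalAll [] xs []
    ev-∷  : ∀ {m n} {g : Code n} {gs : Vec (Code n) m} {xs y ys} →
            Eval g xs y → EvalAll gs xs ys → EvalAll (g ∷ gs) xs (y ∷ ys)

SetN : Set₁
SetN = ℕ → Set

ComputableFun : (ℕ → ℕ) → Set
ComputableFun h = Σ (Code 1) λ c → ∀ x → Eval c (x ∷ []) (h x)

ComputableSet : SetN → Set
ComputableSet R = Σ (ℕ → ℕ) λ χ → ComputableFun χ × (∀ x → R x ⇔ (χ x ≡ 0))

CE : SetN → Set
CE W = Σ (Code 1) λ c → ∀ x → W x ⇔ (Σ ℕ λ y → Eval c (x ∷ []) y)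

_⊆_ : SetN → SetN → Set
X ⊆ Y = ∀ x → X x → Y x

compl : SetN → SetN
compl X x = ¬ X x

_∖_ : SetN → SetN → SetN
(X ∖ Y) x = X x × ¬ Y x

_∪_ : SetN → SetN → SetN
(X ∪ Y) x = X x ⊎ Y x

∅ : SetN
∅ _ = ⊥

Finite : SetN → Set
Finite X = Σ ℕ λ n → ∀ x → X x → x < n

Infinite : SetN → Set
Infinite X = ¬ Finite X

_⊆*_ : SetN → SetN → Set
X ⊆* Y = Finite (X ∖ Y)

Disjoint : SetN → SetN → Set
Disjoint X Y = ∀ x → X x → Y x → ⊥

preimage : (ℕ → ℕ) → SetN → SetN
preimage f K x = K (f x)

rng : (ℕ → ℕ) → SetN
rng f x = Σ ℕ λ y → f y ≡ x

ManyOne : SetN → SetN → (ℕ → ℕ) → Set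
ManyOne A B h = ComputableFun h × (∀ x → A x ⇔ B (h x))

_≤m_ : SetN → SetN → Set
A ≤m B = Σ (ℕ → ℕ) λ h → ManyOne A B h

_≡m_ : SetN → SetN → Set
A ≡m B = (A ≤m B) × (B ≤m A)

Dh : SetN → (ℕ → ℕ) → SetN
Dh A h x = ¬ A x × (Σ ℕ λ y → y < x × ¬ A y × h y ≡ h x)

DMaximal : SetN → Set₁
DMaximal A = CE A × ¬ ComputableSet A ×
  (∀ W → CE W → A ⊆ W →
     CE (W ∖ A) ⊎ (Σ SetN λ R → ComputableSet R × A ⊆ R × R ⊆ W))

-- The one-element family {G} generates 𝒟(A)
-- (members are c.e. and disjoint from A; for a singleton family the union
--  over a finite F ⊆ {G} is either ∅ or G, and D ⊆* ∅ implies D ⊆* G).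
GeneratesSingleton : SetN → SetN → Set₁
GeneratesSingleton A G = CE G × Disjoint G A ×
  (∀ D → CE D → Disjoint D A → D ⊆* G)

GenType1 : SetN → Set₁
GenType1 A = GeneratesSingleton A ∅

GenType2 : SetN → Set₁
GenType2 A = Σ SetN λ R → ComputableSet R × Infinite R × GeneratesSingleton A R

GenType3 : SetN → Set₁
GenType3 A = Σ SetN λ W → CE W × Infinite W × ¬ ComputableSet W × GeneratesSingleton A W

IsType3 : SetN → Set₁
IsType3 A = GenType3 A × ¬ GenType1 A × ¬ GenType2 A

-- Take K to be the generator W of 𝒟(A) of Type 3. A computable set Q ⊇ W
-- disjoint from A would generate 𝒟(A) as well, making A of Type 2; so W is
-- computably inseparable from A.
--
-- (1) If f⁻¹(W) lay below n, apply D-maximality to A ∪ f[n, ∞), which misses W.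
-- A computable set between the two would have a complement separating W from A.
-- Otherwise the difference with A is c.e. and disjoint from A, hence ⊆* W, hence
-- finite, say below m; then every x ∈ W has h x < n with h x ∉ B, or
-- f (h x) < m with f (h x) ∉ A, and this finite information again yields a
-- computable separator.
--
-- (2) Apply D-maximality to A ∪ rng f. If the difference with A is c.e., its
-- preimage under f ∘ h is c.e., disjoint from A, and contains every x ∉ A; if a
-- computable M lies in between, its complement is disjoint from A and contains
-- every x ∉ A ∪ rng f. Either set is ⊆* W, so ω ∖ (A ∪ rng f ∪ W) is finite, and
-- D_h ⊆ ω ∖ A.
--
-- Closure of c.e. sets under union is dovetailing: a clocked evaluator, shown to
-- be sound, monotone and complete, is itself primitive recursive.

{-# OPTIONS --safe #-}
module Submission where

open import Defs
open import Data.Nat using (ℕ; zero; suc; _+_; _∸_; _≤_; _<_; _⊔_) renaming (pred to predℕ)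
open import Data.Nat.Properties
open import Data.Fin using (Fin; zero; suc; _↑ʳ_)
open import Data.Vec using (Vec; []; _∷_; lookup; map; allFin; _++_; head; tail)
open import Data.Vec.Properties using (map-cong; lookup-++ʳ; map-lookup-allFin)
open import Data.List using (List; []; _∷_)
open import Data.List.Membership.Propositional using (_∈_)
open import Data.List.Relation.Unary.Any using (here; there)
open import Data.List.Relation.Unary.Any.Properties using (∷↔)
open import Data.Empty using (⊥)
open import Data.Product using (Σ; ∃; _×_; _,_; proj₁; proj₂)
open import Data.Product.Function.Dependent.Propositional using () renaming (congˡ to ∃-congˡ)
open import Data.Sum using (_⊎_; inj₁; inj₂; [_,_]; map₂)
import Data.Sum as Sum
open import Data.Sum.Function.Propositional using (_⊎-⇔_)
open import Function using (_∘_; id)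
open import Function.Bundles using (_⇔_; mk⇔; Equivalence)
open import Function.Properties.Equivalence using () renaming (trans to ⇔-trans; sym to ⇔-sym)
open import Function.Properties.Inverse using (↔⇒⇔)
open import Function.Related.Propositional using (module EquationalReasoning)
open import Function.Related.TypeIsomorphisms using (Σ-distribˡ-⊎)
open import Relation.Binary using (tri<; tri≈; tri>)
open import Relation.Binary.PropositionalEquality using (_≡_; refl; sym; trans; cong; cong₂; subst; module ≡-Reasoning)
open import Relation.Nullary using (¬_; yes; no; contradiction)
open import Relation.Nullary.Decidable using (¬¬-excluded-middle)
open import Relation.Nullary.Negation using (¬¬-map)

open Equivalence

private
  variable
    m n : ℕ

-- Primitive recursive terms

data PR : ℕ → Set where
  Z : PR n
  S : PR 1
  P : Fin n → PR n
  C : PR m → Vec (PR n) m → PR n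
  R : PR n → PR (suc (suc n)) → PR (suc n)

mutual
  ⟦_⟧ : PR n → Vec ℕ n → ℕ
  ⟦ Z ⟧ xs = 0
  ⟦ S ⟧ (x ∷ []) = suc x
  ⟦ P i ⟧ xs = lookup xs i
  ⟦ C f gs ⟧ xs = ⟦ f ⟧ (⟦ gs ⟧* xs)
  ⟦ R f g ⟧ (k ∷ xs) = rec f g k xs

  ⟦_⟧* : Vec (PR n) m → Vec ℕ n → Vec ℕ m
  ⟦ [] ⟧* xs = []
  ⟦ g ∷ gs ⟧* xs = ⟦ g ⟧ xs ∷ ⟦ gs ⟧* xs

  rec : PR n → PR (suc (suc n)) → ℕ → Vec ℕ n → ℕ
  rec f g zero xs = ⟦ f ⟧ xs
  rec f g (suc k) xs = ⟦ g ⟧ (k ∷ rec f g k xs ∷ xs)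

mutual
  toCode : PR n → Code n
  toCode Z = zer
  toCode S = succ
  toCode (P i) = proj i
  toCode (C f gs) = comp (toCode f) (toCode* gs)
  toCode (R f g) = prec (toCode f) (toCode g)

  toCode* : Vec (PR n) m → Vec (Code n) m
  toCode* [] = []
  toCode* (g ∷ gs) = toCode g ∷ toCode* gs

mutual
  eval-toCode : (p : PR n) (xs : Vec ℕ n) → Eval (toCode p) xs (⟦ p ⟧ xs)
  eval-toCode Z xs = ev-zer
  eval-toCode S (x ∷ []) = ev-succ
  eval-toCode (P i) xs = ev-proj
  eval-toCode (C f gs) xs = ev-comp (evalAll-toCode* gs xs) (eval-toCode f _)
  eval-toCode (R f g) (k ∷ xs) = eval-rec f g k xs

  evalAll-toCode* : (gs : Vec (PR n) m) (xs : Vec ℕ n) → EvalAll (toCode* gs) xs (⟦ gs ⟧* xs)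
  evalAll-toCode* [] xs = ev-[]
  evalAll-toCode* (g ∷ gs) xs = ev-∷ (eval-toCode g xs) (evalAll-toCode* gs xs)

  eval-rec : (f : PR n) (g : PR (suc (suc n))) (k : ℕ) (xs : Vec ℕ n) →
             Eval (prec (toCode f) (toCode g)) (k ∷ xs) (rec f g k xs)
  eval-rec f g zero xs = ev-prec-z (eval-toCode f xs)
  eval-rec f g (suc k) xs = ev-prec-s (eval-rec f g k xs) (eval-toCode g _)

one : PR n
one = C S (Z ∷ [])

predPR : PR 1
predPR = R Z (P zero)

condPR : PR 3
condPR = R (P zero) (P (suc (suc (suc zero))))

Pred : PR n → PR n
Pred a = C predPR (a ∷ [])

Cond : PR n → PR n → PR n → PR n
Cond a b c = C condPR (a ∷ b ∷ c ∷ [])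

-- Defined as denotations so that the clocked evaluator below, which is written
-- with them, is represented by a primitive recursive term by mere computation.
pred : ℕ → ℕ
pred a = ⟦ predPR ⟧ (a ∷ [])

cond : ℕ → ℕ → ℕ → ℕ
cond a b c = ⟦ condPR ⟧ (a ∷ b ∷ c ∷ [])

-- Predicates are represented by functions vanishing exactly on them, as in ComputableSet.
notPR : PR 1
notPR = Cond (P zero) one Z

orPR : PR 2
orPR = Cond (P zero) Z (P (suc zero))

monusPR : PR 2
monusPR = R (P zero) (Pred (P (suc zero)))

eqPR : PR 2
eqPR = Cond (C monusPR (P (suc zero) ∷ P zero ∷ [])) (C monusPR (P zero ∷ P (suc zero) ∷ [])) one

constPR : ℕ → PR n
constPR zero = Z
constPR (suc k) = C S (constPR k ∷ [])

plusPR : ℕ → PR 1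
plusPR zero = P zero
plusPR (suc k) = C S (plusPR k ∷ [])

memberPR : List ℕ → PR 1
memberPR [] = one
memberPR (l ∷ L) = C orPR (C eqPR (P zero ∷ constPR l ∷ []) ∷ memberPR L ∷ [])

notPR-zero⇔ : ∀ a → ⟦ notPR ⟧ (a ∷ []) ≡ 0 ⇔ ∃ λ k → a ≡ suc k
notPR-zero⇔ zero = mk⇔ (λ ()) (λ ())
notPR-zero⇔ (suc a) = mk⇔ (λ _ → a , refl) (λ _ → refl)

orPR-zero⇔ : ∀ a b → ⟦ orPR ⟧ (a ∷ b ∷ []) ≡ 0 ⇔ (a ≡ 0 ⊎ b ≡ 0)
orPR-zero⇔ zero b = mk⇔ (λ _ → inj₁ refl) (λ _ → refl)
orPR-zero⇔ (suc a) b = mk⇔ inj₂ [ (λ ()) , id ]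

pred≡predℕ : ∀ a → pred a ≡ predℕ a
pred≡predℕ zero = refl
pred≡predℕ (suc a) = refl

⟦monusPR⟧ : ∀ k a → ⟦ monusPR ⟧ (k ∷ a ∷ []) ≡ a ∸ k
⟦monusPR⟧ zero a = refl
⟦monusPR⟧ (suc k) a = trans (cong pred (⟦monusPR⟧ k a)) (trans (pred≡predℕ (a ∸ k)) (pred[m∸n]≡m∸[1+n] a k))

cond-∸-zero⇔ : ∀ a b → cond (a ∸ b) (b ∸ a) 1 ≡ 0 ⇔ a ≡ b
cond-∸-zero⇔ zero zero = mk⇔ (λ _ → refl) (λ _ → refl)
cond-∸-zero⇔ zero (suc b) = mk⇔ (λ ()) (λ ())
cond-∸-zero⇔ (suc a) zero = mk⇔ (λ ()) (λ ())
cond-∸-zero⇔ (suc a) (suc b) = mk⇔ (cong suc ∘ to (cond-∸-zero⇔ a b)) (from (cond-∸-zero⇔ a b) ∘ suc-injective)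

eqPR-zero⇔ : ∀ a b → ⟦ eqPR ⟧ (a ∷ b ∷ []) ≡ 0 ⇔ a ≡ b
eqPR-zero⇔ a b rewrite ⟦monusPR⟧ b a | ⟦monusPR⟧ a b = cond-∸-zero⇔ a b

⟦constPR⟧ : ∀ k (xs : Vec ℕ n) → ⟦ constPR k ⟧ xs ≡ k
⟦constPR⟧ zero xs = refl
⟦constPR⟧ (suc k) xs = cong suc (⟦constPR⟧ k xs)

⟦plusPR⟧ : ∀ k z → ⟦ plusPR k ⟧ (z ∷ []) ≡ k + z
⟦plusPR⟧ zero z = refl
⟦plusPR⟧ (suc k) z = cong suc (⟦plusPR⟧ k z)

memberPR-zero⇔ : ∀ L v → ⟦ memberPR L ⟧ (v ∷ []) ≡ 0 ⇔ v ∈ L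
memberPR-zero⇔ [] v = mk⇔ (λ ()) (λ ())
memberPR-zero⇔ (l ∷ L) v
  rewrite ⟦constPR⟧ l (v ∷ [])
  = ⇔-trans (orPR-zero⇔ _ _) (⇔-trans (eqPR-zero⇔ v l ⊎-⇔ memberPR-zero⇔ L v) (↔⇒⇔ (∷↔ (v ≡_))))

-- A clocked evaluator

allPos : Vec ℕ m → ℕ
allPos [] = 1
allPos (v ∷ vs) = cond v 0 (allPos vs)

-- search v k scans z < k, where v z is a clocked value as returned by run below:
-- the state is 0 while the searched function has returned positive values so far,
-- 1 once it did not halt in time at some z, and suc (suc y) once it returned 0 at y.
searchStep : ℕ → ℕ → ℕ → ℕ
searchStep k st v = cond st (cond v 1 (cond (pred v) (suc (suc k)) 0)) st

search : (ℕ → ℕ) → ℕ → ℕ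
search v zero = 0
search v (suc k) = searchStep k (search v k) (v k)

-- run c s xs is suc y if c halts on xs with output y when every unbounded search
-- is cut off after s candidates, and 0 otherwise.
mutual
  run : Code n → ℕ → Vec ℕ n → ℕ
  run zer s xs = 1
  run succ s (x ∷ []) = suc (suc x)
  run (proj i) s xs = suc (lookup xs i)
  run (comp f gs) s xs = cond (allPos (runAll gs s xs)) 0 (run f s (map pred (runAll gs s xs)))
  run (prec f g) s (k ∷ xs) = runRec f g s k xs
  run (mu f) s xs = pred (search (λ z → run f s (z ∷ xs)) s)

  runAll : Vec (Code n) m → ℕ → Vec ℕ n → Vec ℕ m
  runAll [] s xs = []
  runAll (g ∷ gs) s xs = run g s xs ∷ runAll gs s xs

  runRec : Code n → Code (suc (suc n)) → ℕ → ℕ → Vec ℕ n → ℕ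
  runRec f g s zero xs = run f s xs
  runRec f g s (suc k) xs = cond (runRec f g s k xs) 0 (run g s (k ∷ pred (runRec f g s k xs) ∷ xs))

module Search (v : ℕ → ℕ) where

  Positive : ℕ → Set
  Positive z = ∃ λ j → v z ≡ suc (suc j)

  FirstZero : ℕ → Set
  FirstZero y = v y ≡ 1 × (∀ z → z < y → Positive z)

  search≡0⇒positive : ∀ k → search v k ≡ 0 → ∀ z → z < k → Positive z
  search≡0⇒positive (suc k) eq z z<1+k with search v k in e | v k in ev
  search≡0⇒positive (suc k) () z z<1+k | suc _ | _
  search≡0⇒positive (suc k) () z z<1+k | zero | zero
  search≡0⇒positive (suc k) () z z<1+k | zero | suc zero
  ... | zero | suc (suc j) with m<1+n⇒m<n∨m≡n z<1+k
  ...   | inj₁ z<k = search≡0⇒positive k e z z<k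
  ...   | inj₂ refl = j , ev

  search≡2+⇒firstZero : ∀ k {y} → search v k ≡ suc (suc y) → y < k × FirstZero y
  search≡2+⇒firstZero (suc k) eq with search v k in e | v k in ev
  ... | suc (suc _) | _ with refl ← eq = let (y<k , first) = search≡2+⇒firstZero k e in m<n⇒m<1+n y<k , first
  search≡2+⇒firstZero (suc k) () | suc zero | _
  search≡2+⇒firstZero (suc k) () | zero | zero
  ... | zero | suc zero with refl ← eq = n<1+n k , ev , search≡0⇒positive k e
  search≡2+⇒firstZero (suc k) () | zero | suc (suc _)

  positive⇒search≡0 : ∀ k → (∀ z → z < k → Positive z) → search v k ≡ 0
  positive⇒search≡0 zero _ = refl
  positive⇒search≡0 (suc k) pos
    rewrite positive⇒search≡0 k (λ z z<k → pos z (m<n⇒m<1+n z<k))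
          | proj₂ (pos k (n<1+n k)) = refl

  firstZero⇒search≡2+ : ∀ k {y} → y < k → FirstZero y → search v k ≡ suc (suc y)
  firstZero⇒search≡2+ (suc k) y<1+k first@(vy≡1 , pos) with m<1+n⇒m<n∨m≡n y<1+k
  ... | inj₁ y<k rewrite firstZero⇒search≡2+ k y<k first = refl
  ... | inj₂ refl rewrite positive⇒search≡0 k pos | vy≡1 = refl

open Search using (search≡2+⇒firstZero; firstZero⇒search≡2+)

allPos-map-suc : (ys : Vec ℕ m) → allPos (map suc ys) ≡ 1
allPos-map-suc [] = refl
allPos-map-suc (y ∷ ys) = allPos-map-suc ys

map-pred-map-suc : (ys : Vec ℕ m) → map pred (map suc ys) ≡ ys
map-pred-map-suc [] = refl
map-pred-map-suc (y ∷ ys) = cong (y ∷_) (map-pred-map-suc ys)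

allPos≡suc⇒map-suc : (vs : Vec ℕ m) {q : ℕ} → allPos vs ≡ suc q → vs ≡ map suc (map pred vs)
allPos≡suc⇒map-suc [] e = refl
allPos≡suc⇒map-suc (suc v ∷ vs) e = cong (suc v ∷_) (allPos≡suc⇒map-suc vs e)

run-comp : (f : Code m) (gs : Vec (Code n) m) {s : ℕ} {xs : Vec ℕ n} {ys : Vec ℕ m} →
           runAll gs s xs ≡ map suc ys → run (comp f gs) s xs ≡ run f s ys
run-comp f gs {ys = ys} e rewrite e | allPos-map-suc ys | map-pred-map-suc ys = refl

runRec-suc : (f : Code n) (g : Code (suc (suc n))) {s k : ℕ} {xs : Vec ℕ n} {r : ℕ} →
             runRec f g s k xs ≡ suc r → runRec f g s (suc k) xs ≡ run g s (k ∷ r ∷ xs)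
runRec-suc f g e rewrite e = refl

mutual
  run-sound : (c : Code n) {s : ℕ} (xs : Vec ℕ n) {y : ℕ} → run c s xs ≡ suc y → Eval c xs y
  run-sound zer xs refl = ev-zer
  run-sound succ (x ∷ []) refl = ev-succ
  run-sound (proj i) xs refl = ev-proj
  run-sound (comp f gs) {s} xs eq with allPos (runAll gs s xs) in e
  ... | suc _ = ev-comp (runAll-sound gs xs e) (run-sound f _ eq)
  run-sound (prec f g) (k ∷ xs) eq = runRec-sound f g k xs eq
  run-sound (mu f) {s} xs eq with search (λ z → run f s (z ∷ xs)) s in e
  ... | suc (suc y) with refl ← eq =
    let (_ , returns0 , positive) = search≡2+⇒firstZero (λ z → run f s (z ∷ xs)) s e
    in ev-mu (run-sound f _ returns0)
             (λ z z<y → let (j , ej) = positive z z<y in j , run-sound f _ ej)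

  runAll-sound : (gs : Vec (Code n) m) {s : ℕ} (xs : Vec ℕ n) {q : ℕ} →
                 allPos (runAll gs s xs) ≡ suc q → EvalAll gs xs (map pred (runAll gs s xs))
  runAll-sound [] xs e = ev-[]
  runAll-sound (g ∷ gs) {s} xs e with run g s xs in eg
  ... | suc _ = ev-∷ (run-sound g xs eg) (runAll-sound gs xs e)

  runRec-sound : (f : Code n) (g : Code (suc (suc n))) {s : ℕ} (k : ℕ) (xs : Vec ℕ n) {y : ℕ} →
                 runRec f g s k xs ≡ suc y → Eval (prec f g) (k ∷ xs) y
  runRec-sound f g zero xs eq = ev-prec-z (run-sound f xs eq)
  runRec-sound f g {s} (suc k) xs eq with runRec f g s k xs in e
  ... | suc r = ev-prec-s (runRec-sound f g k xs e) (run-sound g _ eq)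

mutual
  run-mono : (c : Code n) {s t : ℕ} (xs : Vec ℕ n) {y : ℕ} → s ≤ t → run c s xs ≡ suc y → run c t xs ≡ suc y
  run-mono zer xs s≤t eq = eq
  run-mono succ (x ∷ []) s≤t eq = eq
  run-mono (proj i) xs s≤t eq = eq
  run-mono (comp f gs) {s} xs s≤t eq with allPos (runAll gs s xs) in e
  ... | suc _ =
    trans (run-comp f gs (runAll-mono gs xs s≤t (allPos≡suc⇒map-suc (runAll gs s xs) e)))
          (run-mono f _ s≤t eq)
  run-mono (prec f g) (k ∷ xs) s≤t eq = runRec-mono f g k xs s≤t eq
  run-mono (mu f) {s} {t} xs s≤t eq with search (λ z → run f s (z ∷ xs)) s in e
  ... | suc (suc y) with refl ← eq =
    let (y<s , returns0 , positive) = search≡2+⇒firstZero (λ z → run f s (z ∷ xs)) s e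
    in cong pred (firstZero⇒search≡2+ (λ z → run f t (z ∷ xs)) t (≤-trans y<s s≤t)
         (run-mono f _ s≤t returns0 , λ z z<y → positive-mono f xs z s≤t (positive z z<y)))

  runAll-mono : (gs : Vec (Code n) m) {s t : ℕ} (xs : Vec ℕ n) {ys : Vec ℕ m} → s ≤ t →
                runAll gs s xs ≡ map suc ys → runAll gs t xs ≡ map suc ys
  runAll-mono [] xs {[]} s≤t e = refl
  runAll-mono (g ∷ gs) xs {y ∷ ys} s≤t e =
    cong₂ _∷_ (run-mono g xs s≤t (cong head e)) (runAll-mono gs xs s≤t (cong tail e))

  runRec-mono : (f : Code n) (g : Code (suc (suc n))) {s t : ℕ} (k : ℕ) (xs : Vec ℕ n) {y : ℕ} →
                s ≤ t → runRec f g s k xs ≡ suc y → runRec f g t k xs ≡ suc y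
  runRec-mono f g zero xs s≤t eq = run-mono f xs s≤t eq
  runRec-mono f g {s} (suc k) xs s≤t eq with runRec f g s k xs in e
  ... | suc r = trans (runRec-suc f g (runRec-mono f g k xs s≤t e)) (run-mono g _ s≤t eq)

  positive-mono : (f : Code (suc n)) (xs : Vec ℕ n) (z : ℕ) {s t : ℕ} → s ≤ t →
                  Search.Positive (λ w → run f s (w ∷ xs)) z → Search.Positive (λ w → run f t (w ∷ xs)) z
  positive-mono f xs z s≤t (j , e) = j , run-mono f _ s≤t e

common-bound : (Q : ℕ → ℕ → Set) → (∀ z {s t} → s ≤ t → Q z s → Q z t) →
               ∀ y → (∀ z → z < y → ∃ (Q z)) → ∃ λ s → ∀ z → z < y → Q z s
common-bound Q mono zero _ = 0 , λ z ()
common-bound Q mono (suc y) bounds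
  with common-bound Q mono y (λ z z<y → bounds z (m<n⇒m<1+n z<y)) | bounds y (n<1+n y)
... | (s , below) | (t , at) = s ⊔ t , λ z z<1+y → [ (λ z<y → mono z (m≤m⊔n s t) (below z z<y))
                                                    , (λ { refl → mono z (m≤n⊔m s t) at }) ]
                                                    (m<1+n⇒m<n∨m≡n z<1+y)

mutual
  run-complete : {c : Code n} {xs : Vec ℕ n} {y : ℕ} → Eval c xs y → ∃ λ s → run c s xs ≡ suc y
  run-complete ev-zer = 0 , refl
  run-complete ev-succ = 0 , refl
  run-complete ev-proj = 0 , refl
  run-complete {c = comp f gs} (ev-comp args e) with runAll-complete args | run-complete e
  ... | (s , es) | (t , et) =
    s ⊔ t , trans (run-comp f gs (runAll-mono gs _ (m≤m⊔n s t) es)) (run-mono f _ (m≤n⊔m s t) et)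
  run-complete (ev-prec-z e) = run-complete e
  run-complete {c = prec f g} (ev-prec-s {k = k} {xs = xs} p e) with run-complete p | run-complete e
  ... | (s , es) | (t , et) =
    s ⊔ t , trans (runRec-suc f g (runRec-mono f g k xs (m≤m⊔n s t) es)) (run-mono g _ (m≤n⊔m s t) et)
  run-complete {c = mu f} {xs} {y} (ev-mu e below) with run-complete e | prefix-clock below
  ... | (s , es) | (t , et) =
    let u = suc y ⊔ s ⊔ t in
    u , cong pred (firstZero⇒search≡2+ (λ z → run f u (z ∷ xs)) u
          (≤-trans (m≤m⊔n (suc y) s) (m≤m⊔n _ t))
          (run-mono f _ (≤-trans (m≤n⊔m (suc y) s) (m≤m⊔n _ t)) es ,
           λ z z<y → positive-mono f xs z (m≤n⊔m _ t) (et z z<y)))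

  runAll-complete : {gs : Vec (Code n) m} {xs : Vec ℕ n} {ys : Vec ℕ m} →
                    EvalAll gs xs ys → ∃ λ s → runAll gs s xs ≡ map suc ys
  runAll-complete ev-[] = 0 , refl
  runAll-complete {gs = g ∷ gs} (ev-∷ e args) with run-complete e | runAll-complete args
  ... | (s , es) | (t , et) =
    s ⊔ t , cong₂ _∷_ (run-mono g _ (m≤m⊔n s t) es) (runAll-mono gs _ (m≤n⊔m s t) et)

  prefix-clock : {f : Code (suc n)} {xs : Vec ℕ n} {y : ℕ} →
                 (∀ z → z < y → ∃ λ k → Eval f (z ∷ xs) (suc k)) →
                 ∃ λ s → ∀ z → z < y → Search.Positive (λ w → run f s (w ∷ xs)) z
  prefix-clock {f = f} {xs} {y} below =
    common-bound (λ z s → Search.Positive (λ w → run f s (w ∷ xs)) z) (positive-mono f xs) y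
                 (λ z z<y → positive-clock (below z z<y))

  positive-clock : {f : Code (suc n)} {xs : Vec ℕ n} {z : ℕ} → (∃ λ k → Eval f (z ∷ xs) (suc k)) →
                   ∃ λ s → Search.Positive (λ w → run f s (w ∷ xs)) z
  positive-clock (k , e) = let (s , es) = run-complete e in s , k , es

dropPR : ∀ k → Vec (PR (k + n)) n
dropPR {n} k = map (λ i → P (k ↑ʳ i)) (allFin n)

⟦map-P⟧ : ∀ {k} (f : Fin m → Fin n) (is : Vec (Fin m) k) (zs : Vec ℕ n) →
          ⟦ map (λ i → P (f i)) is ⟧* zs ≡ map (λ i → lookup zs (f i)) is
⟦map-P⟧ f [] zs = refl
⟦map-P⟧ f (i ∷ is) zs = cong (_ ∷_) (⟦map-P⟧ f is zs)

⟦dropPR⟧ : ∀ k (ys : Vec ℕ k) (xs : Vec ℕ n) → ⟦ dropPR k ⟧* (ys ++ xs) ≡ xs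
⟦dropPR⟧ {n} k ys xs = begin
  ⟦ dropPR k ⟧* (ys ++ xs)                        ≡⟨ ⟦map-P⟧ (k ↑ʳ_) (allFin n) (ys ++ xs) ⟩
  map (λ i → lookup (ys ++ xs) (k ↑ʳ i)) (allFin n) ≡⟨ map-cong (lookup-++ʳ ys xs) (allFin n) ⟩
  map (lookup xs) (allFin n)                        ≡⟨ map-lookup-allFin xs ⟩
  xs                                                ∎
  where open ≡-Reasoning

AllPos : Vec (PR n) m → PR n
AllPos [] = one
AllPos (t ∷ ts) = Cond t Z (AllPos ts)

⟦AllPos⟧ : (ts : Vec (PR n) m) (ys : Vec ℕ n) → ⟦ AllPos ts ⟧ ys ≡ allPos (⟦ ts ⟧* ys)
⟦AllPos⟧ [] ys = refl
⟦AllPos⟧ (t ∷ ts) ys = cong (cond (⟦ t ⟧ ys) 0) (⟦AllPos⟧ ts ys)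

⟦map-Pred⟧ : (ts : Vec (PR n) m) (ys : Vec ℕ n) → ⟦ map Pred ts ⟧* ys ≡ map pred (⟦ ts ⟧* ys)
⟦map-Pred⟧ [] ys = refl
⟦map-Pred⟧ (t ∷ ts) ys = cong (_ ∷_) (⟦map-Pred⟧ ts ys)

searchStepPR : PR 3
searchStepPR = Cond (P (suc zero)) (Cond v one (Cond (Pred v) (C S (C S (P zero ∷ []) ∷ [])) Z)) (P (suc zero))
  where
  v : PR 3
  v = P (suc (suc zero))

-- The step terms receive the recursion index, the previous value, the clock and the inputs.
mutual
  runPR : Code n → PR (suc n)
  runPR zer = one
  runPR succ = C S (C S (P (suc zero) ∷ []) ∷ [])
  runPR (proj i) = C S (P (suc i) ∷ [])
  runPR (comp f gs) = Cond (AllPos (runPR* gs)) Z (C (runPR f) (P zero ∷ map Pred (runPR* gs)))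
  runPR (prec f g) = C (R (runPR f) (precStepPR g)) (P (suc zero) ∷ P zero ∷ dropPR 2)
  runPR (mu f) = Pred (C (R Z (muStepPR f)) (P zero ∷ P zero ∷ dropPR 1))

  runPR* : Vec (Code n) m → Vec (PR (suc n)) m
  runPR* [] = []
  runPR* (g ∷ gs) = runPR g ∷ runPR* gs

  precStepPR : Code (suc (suc n)) → PR (suc (suc (suc n)))
  precStepPR g = Cond (P (suc zero)) Z (C (runPR g) (P (suc (suc zero)) ∷ P zero ∷ Pred (P (suc zero)) ∷ dropPR 3))

  muStepPR : Code (suc n) → PR (suc (suc (suc n)))
  muStepPR f = C searchStepPR (P zero ∷ P (suc zero) ∷ C (runPR f) (P (suc (suc zero)) ∷ P zero ∷ dropPR 3) ∷ [])

mutual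
  ⟦runPR⟧ : (c : Code n) (s : ℕ) (xs : Vec ℕ n) → ⟦ runPR c ⟧ (s ∷ xs) ≡ run c s xs
  ⟦runPR⟧ zer s xs = refl
  ⟦runPR⟧ succ s (x ∷ []) = refl
  ⟦runPR⟧ (proj i) s xs = refl
  ⟦runPR⟧ (comp f gs) s xs
    rewrite ⟦AllPos⟧ (runPR* gs) (s ∷ xs) | ⟦map-Pred⟧ (runPR* gs) (s ∷ xs) | ⟦runPR*⟧ gs s xs
    = cong (cond (allPos (runAll gs s xs)) 0) (⟦runPR⟧ f s (map pred (runAll gs s xs)))
  ⟦runPR⟧ (prec f g) s (k ∷ xs) rewrite ⟦dropPR⟧ 2 (s ∷ k ∷ []) xs = ⟦rec-precStepPR⟧ f g s k xs
  ⟦runPR⟧ (mu f) s xs rewrite ⟦dropPR⟧ 1 (s ∷ []) xs = cong pred (⟦rec-muStepPR⟧ f s xs s)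

  ⟦runPR*⟧ : (gs : Vec (Code n) m) (s : ℕ) (xs : Vec ℕ n) → ⟦ runPR* gs ⟧* (s ∷ xs) ≡ runAll gs s xs
  ⟦runPR*⟧ [] s xs = refl
  ⟦runPR*⟧ (g ∷ gs) s xs = cong₂ _∷_ (⟦runPR⟧ g s xs) (⟦runPR*⟧ gs s xs)

  ⟦rec-precStepPR⟧ : (f : Code n) (g : Code (suc (suc n))) (s k : ℕ) (xs : Vec ℕ n) →
                     rec (runPR f) (precStepPR g) k (s ∷ xs) ≡ runRec f g s k xs
  ⟦rec-precStepPR⟧ f g s zero xs = ⟦runPR⟧ f s xs
  ⟦rec-precStepPR⟧ f g s (suc k) xs
    rewrite ⟦dropPR⟧ 3 (k ∷ rec (runPR f) (precStepPR g) k (s ∷ xs) ∷ s ∷ []) xs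
          | ⟦rec-precStepPR⟧ f g s k xs
    = cong (cond (runRec f g s k xs) 0) (⟦runPR⟧ g s _)

  ⟦rec-muStepPR⟧ : (f : Code (suc n)) (s : ℕ) (xs : Vec ℕ n) (k : ℕ) →
                       rec Z (muStepPR f) k (s ∷ xs) ≡ search (λ z → run f s (z ∷ xs)) k
  ⟦rec-muStepPR⟧ f s xs zero = refl
  ⟦rec-muStepPR⟧ f s xs (suc k)
    rewrite ⟦dropPR⟧ 3 (k ∷ rec Z (muStepPR f) k (s ∷ xs) ∷ s ∷ []) xs
          | ⟦rec-muStepPR⟧ f s xs k
          | ⟦runPR⟧ f s (k ∷ xs)
    = refl

-- Closure properties of computable and c.e. sets

mutual
  eval-det : {c : Code n} {xs : Vec ℕ n} {y z : ℕ} → Eval c xs y → Eval c xs z → y ≡ z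
  eval-det ev-zer ev-zer = refl
  eval-det ev-succ ev-succ = refl
  eval-det ev-proj ev-proj = refl
  eval-det (ev-comp a e) (ev-comp b d) with evalAll-det a b
  ... | refl = eval-det e d
  eval-det (ev-prec-z e) (ev-prec-z d) = eval-det e d
  eval-det (ev-prec-s p e) (ev-prec-s q d) with eval-det p q
  ... | refl = eval-det e d
  eval-det (ev-mu {y = y} e below) (ev-mu {y = z} d below′) with <-cmp y z
  ... | tri≈ _ y≡z _ = y≡z
  ... | tri< y<z _ _ = contradiction (eval-det e (proj₂ (below′ y y<z))) 0≢1+n
  ... | tri> _ _ z<y = contradiction (eval-det d (proj₂ (below z z<y))) 0≢1+n

  evalAll-det : {gs : Vec (Code n) m} {xs : Vec ℕ n} {ys zs : Vec ℕ m} →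
                EvalAll gs xs ys → EvalAll gs xs zs → ys ≡ zs
  evalAll-det ev-[] ev-[] = refl
  evalAll-det (ev-∷ e a) (ev-∷ d b) = cong₂ _∷_ (eval-det e d) (evalAll-det a b)

Halts : Code n → Vec ℕ n → Set
Halts c xs = ∃ λ y → Eval c xs y

haltedPR : Code n → PR (suc n)
haltedPR c = C notPR (runPR c ∷ [])

halts⇔halted : (c : Code n) (xs : Vec ℕ n) → Halts c xs ⇔ ∃ λ s → ⟦ haltedPR c ⟧ (s ∷ xs) ≡ 0
halts⇔halted c xs = mk⇔
  (λ (y , e) → let (s , es) = run-complete e in s , from (notPR-zero⇔ _) (y , trans (⟦runPR⟧ c s xs) es))
  (λ (s , e) → let (y , es) = to (notPR-zero⇔ _) e in y , run-sound c xs (trans (sym (⟦runPR⟧ c s xs)) es))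

LeastZero : (ℕ → ℕ) → ℕ → Set
LeastZero F y = F y ≡ 0 × (∀ z → z < y → ∃ λ k → F z ≡ suc k)

least-zero-below : (F : ℕ → ℕ) → ∀ b → (∀ z → z < b → ∃ λ k → F z ≡ suc k) ⊎ ∃ (LeastZero F)
least-zero-below F zero = inj₁ (λ _ ())
least-zero-below F (suc b) with least-zero-below F b
... | inj₂ least = inj₂ least
... | inj₁ positive with F b in e
...   | zero = inj₂ (b , e , positive)
...   | suc k = inj₁ λ z z<1+b → [ positive z , (λ { refl → k , e }) ] (m<1+n⇒m<n∨m≡n z<1+b)

least-zero : (F : ℕ → ℕ) → ∃ (λ z → F z ≡ 0) → ∃ (LeastZero F)
least-zero F (z , Fz≡0) with least-zero-below F (suc z)
... | inj₂ least = least
... | inj₁ positive = let (k , Fz≡1+k) = positive z (n<1+n z) in contradiction (trans (sym Fz≡1+k) Fz≡0) 1+n≢0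

halts-mu⇔ : (c : Code (suc n)) (F : ℕ → ℕ) {xs : Vec ℕ n} →
            (∀ z → Eval c (z ∷ xs) (F z)) → Halts (mu c) xs ⇔ ∃ λ z → F z ≡ 0
halts-mu⇔ c F {xs} total = mk⇔
  (λ { (y , ev-mu e _) → y , eval-det (total y) e })
  (λ root → let (y , Fy≡0 , positive) = least-zero F root in
     y , ev-mu (subst (Eval c (y ∷ xs)) Fy≡0 (total y))
               (λ z z<y → let (k , Fz≡1+k) = positive z z<y in k , subst (Eval c (z ∷ xs)) Fz≡1+k (total z)))

computableFun-∘ : {f g : ℕ → ℕ} → ComputableFun f → ComputableFun g → ComputableFun (f ∘ g)
computableFun-∘ {g = g} (cf , ef) (cg , eg) = comp cf (cg ∷ []) , λ x → ev-comp (ev-∷ (eg x) ev-[]) (ef (g x))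

computableFun-PR : (p : PR 1) → ComputableFun (λ x → ⟦ p ⟧ (x ∷ []))
computableFun-PR p = toCode p , λ x → eval-toCode p (x ∷ [])

computableFun-PR₂ : (p : PR 2) {f g : ℕ → ℕ} → ComputableFun f → ComputableFun g →
                    ComputableFun (λ x → ⟦ p ⟧ (f x ∷ g x ∷ []))
computableFun-PR₂ p (cf , ef) (cg , eg) =
  comp (toCode p) (cf ∷ cg ∷ []) , λ x → ev-comp (ev-∷ (ef x) (ev-∷ (eg x) ev-[])) (eval-toCode p _)

computableFun-shift : {f : ℕ → ℕ} → ComputableFun f → ∀ k → ComputableFun (λ z → f (k + z))
computableFun-shift {f} (cf , ef) k = comp cf (toCode (plusPR k) ∷ []) , λ z →
  ev-comp (ev-∷ (subst (Eval _ (z ∷ [])) (⟦plusPR⟧ k z) (eval-toCode (plusPR k) (z ∷ []))) ev-[]) (ef (k + z))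

computable-⇔ : {X Y : SetN} → (∀ x → X x ⇔ Y x) → ComputableSet X → ComputableSet Y
computable-⇔ X⇔Y (χ , cχ , X⇔χ≡0) = χ , cχ , λ x → ⇔-trans (⇔-sym (X⇔Y x)) (X⇔χ≡0 x)

≢0⇔≡suc : ∀ a → (¬ a ≡ 0) ⇔ ∃ λ k → a ≡ suc k
≢0⇔≡suc zero = mk⇔ (λ a≢0 → contradiction refl a≢0) (λ ())
≢0⇔≡suc (suc a) = mk⇔ (λ _ → a , refl) (λ _ ())

computable-compl : {X : SetN} → ComputableSet X → ComputableSet (compl X)
computable-compl (χ , cχ , X⇔χ≡0) =
  (λ x → ⟦ notPR ⟧ (χ x ∷ [])) , computableFun-∘ (computableFun-PR notPR) cχ ,
  λ x → ⇔-trans (mk⇔ (_∘ from (X⇔χ≡0 x)) (_∘ to (X⇔χ≡0 x)))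
                (⇔-trans (≢0⇔≡suc (χ x)) (⇔-sym (notPR-zero⇔ (χ x))))

computable-∪ : {X Y : SetN} → ComputableSet X → ComputableSet Y → ComputableSet (X ∪ Y)
computable-∪ (χ , cχ , X⇔χ≡0) (ψ , cψ , Y⇔ψ≡0) =
  (λ x → ⟦ orPR ⟧ (χ x ∷ ψ x ∷ [])) , computableFun-PR₂ orPR cχ cψ ,
  λ x → ⇔-trans (X⇔χ≡0 x ⊎-⇔ Y⇔ψ≡0 x) (⇔-sym (orPR-zero⇔ (χ x) (ψ x)))

computable-preimage : {X : SetN} {g : ℕ → ℕ} → ComputableSet X → ComputableFun g → ComputableSet (preimage g X)
computable-preimage {g = g} (χ , cχ , X⇔χ≡0) cg = χ ∘ g , computableFun-∘ cχ cg , X⇔χ≡0 ∘ g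

computable-∈ : (L : List ℕ) → ComputableSet (_∈ L)
computable-∈ L = (λ v → ⟦ memberPR L ⟧ (v ∷ [])) , computableFun-PR (memberPR L) , λ v → ⇔-sym (memberPR-zero⇔ L v)

_↾_ : SetN → ℕ → SetN
(X ↾ n) b = b < n × X b

Enumerates : List ℕ → SetN → Set
Enumerates L X = ∀ b → X b ⇔ b ∈ L

↾-suc : {X : SetN} {b : ℕ} → (X ↾ n) b → (X ↾ suc n) b
↾-suc (b<n , Xb) = m<n⇒m<1+n b<n , Xb

enumerates-↾-suc-∷ : {X : SetN} {L : List ℕ} → Enumerates L (X ↾ n) → X n → Enumerates (n ∷ L) (X ↾ suc n)
enumerates-↾-suc-∷ {n} {X} {L} enum Xn b = mk⇔ into out
  where
  into : (X ↾ suc n) b → b ∈ n ∷ L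
  into (b<1+n , Xb) with m<1+n⇒m<n∨m≡n b<1+n
  ... | inj₁ b<n = there (to (enum b) (b<n , Xb))
  ... | inj₂ refl = here refl
  out : b ∈ n ∷ L → (X ↾ suc n) b
  out (here refl) = n<1+n n , Xn
  out (there b∈L) = ↾-suc {X = X} (from (enum b) b∈L)

enumerates-↾-suc : {X : SetN} {L : List ℕ} → Enumerates L (X ↾ n) → ¬ X n → Enumerates L (X ↾ suc n)
enumerates-↾-suc {n} {X} {L} enum ¬Xn b = mk⇔ into (↾-suc {X = X} ∘ from (enum b))
  where
  into : (X ↾ suc n) b → b ∈ L
  into (b<1+n , Xb) with m<1+n⇒m<n∨m≡n b<1+n
  ... | inj₁ b<n = to (enum b) (b<n , Xb)
  ... | inj₂ refl = contradiction Xb ¬Xn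

¬¬enumerate-↾ : (X : SetN) → ∀ n → ¬ ¬ ∃ λ L → Enumerates L (X ↾ n)
¬¬enumerate-↾ X zero k = k ([] , λ b → mk⇔ (λ ()) (λ ()))
¬¬enumerate-↾ X (suc n) k = ¬¬enumerate-↾ X n λ (L , enum) → ¬¬-excluded-middle λ where
  (yes Xn) → k (n ∷ L , enumerates-↾-suc-∷ enum Xn)
  (no ¬Xn) → k (L , enumerates-↾-suc enum ¬Xn)

-- Listing a finite set needs excluded middle below its bound; the double negation
-- is harmless since the separators built from such sets are only used to reach ⊥.
finite⇒¬¬computable : {X : SetN} → Finite X → ¬ ¬ ComputableSet X
finite⇒¬¬computable {X} (n , bounded) = ¬¬-map
  (λ (L , enum) → computable-⇔ (λ b → ⇔-sym (⇔-trans (mk⇔ (λ Xb → bounded b Xb , Xb) proj₂) (enum b)))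
                               (computable-∈ L))
  (¬¬enumerate-↾ X n)

ce-search : {W : SetN} (c : Code 2) (F : ℕ → ℕ → ℕ) → (∀ z x → Eval c (z ∷ x ∷ []) (F z x)) →
            (∀ x → W x ⇔ ∃ λ z → F z x ≡ 0) → CE W
ce-search c F total W⇔ = mu c , λ x → ⇔-trans (W⇔ x) (⇔-sym (halts-mu⇔ c (λ z → F z x) (λ z → total z x)))

computable⇒ce : {X : SetN} → ComputableSet X → CE X
computable⇒ce (χ , (c , ec) , X⇔χ≡0) =
  ce-search (comp c (proj (suc zero) ∷ [])) (λ _ x → χ x) (λ _ x → ev-comp (ev-∷ ev-proj ev-[]) (ec x))
            (λ x → ⇔-trans (X⇔χ≡0 x) (mk⇔ (0 ,_) proj₂))

ce-rng : {g : ℕ → ℕ} → ComputableFun g → CE (rng g)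
ce-rng {g} (cg , eg) =
  ce-search (comp (toCode eqPR) (comp cg (proj zero ∷ []) ∷ proj (suc zero) ∷ []))
            (λ z x → ⟦ eqPR ⟧ (g z ∷ x ∷ []))
            (λ z x → ev-comp (ev-∷ (ev-comp (ev-∷ ev-proj ev-[]) (eg z)) (ev-∷ ev-proj ev-[])) (eval-toCode eqPR _))
            (λ x → ∃-congˡ (⇔-sym (eqPR-zero⇔ _ x)))

ce-∪ : {X Y : SetN} → CE X → CE Y → CE (X ∪ Y)
ce-∪ {X} {Y} (cX , X⇔) (cY , Y⇔) = ce-search (toCode p) (λ s x → ⟦ p ⟧ (s ∷ x ∷ [])) (λ s x → eval-toCode p _) X∪Y⇔
  where
  p : PR 2
  p = C orPR (haltedPR cX ∷ haltedPR cY ∷ [])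
  X∪Y⇔ : ∀ x → (X ∪ Y) x ⇔ ∃ λ s → ⟦ p ⟧ (s ∷ x ∷ []) ≡ 0
  X∪Y⇔ x = begin
    (X ∪ Y) x                                     ∼⟨ X⇔ x ⊎-⇔ Y⇔ x ⟩
    (Halts cX (x ∷ []) ⊎ Halts cY (x ∷ []))       ∼⟨ halts⇔halted cX _ ⊎-⇔ halts⇔halted cY _ ⟩
    ((∃ λ s → ⟦ haltedPR cX ⟧ (s ∷ x ∷ []) ≡ 0) ⊎
     (∃ λ s → ⟦ haltedPR cY ⟧ (s ∷ x ∷ []) ≡ 0))  ↔⟨ Σ-distribˡ-⊎ ⟨
    (∃ λ s → ⟦ haltedPR cX ⟧ (s ∷ x ∷ []) ≡ 0 ⊎
             ⟦ haltedPR cY ⟧ (s ∷ x ∷ []) ≡ 0)   ∼⟨ ∃-congˡ (⇔-sym (orPR-zero⇔ _ _)) ⟩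
    (∃ λ s → ⟦ p ⟧ (s ∷ x ∷ []) ≡ 0)              ∎
    where open EquationalReasoning

ce-preimage : {D : SetN} {g : ℕ → ℕ} → CE D → ComputableFun g → CE (preimage g D)
ce-preimage {D} {g} (cD , D⇔) (cg , eg) = comp cD (cg ∷ []) , λ x → ⇔-trans (D⇔ (g x)) (mk⇔
  (λ (y , e) → y , ev-comp (ev-∷ (eg x) ev-[]) e)
  (λ { (y , ev-comp (ev-∷ e₁ ev-[]) e₂) → y , subst (λ v → Eval cD (v ∷ []) y) (eval-det e₁ (eg x)) e₂ }))

-- D-maximal sets of Type 3

finite-⊆ : {X Y : SetN} → X ⊆ Y → Finite Y → Finite X
finite-⊆ X⊆Y (n , bounded) = n , λ x → bounded x ∘ X⊆Y x

infinite-⊇ : {X Y : SetN} → X ⊆ Y → Infinite X → Infinite Y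
infinite-⊇ X⊆Y infX = infX ∘ finite-⊆ X⊆Y

manyOne-∘ : {A B C : SetN} {h f : ℕ → ℕ} → ManyOne A B h → ManyOne B C f → ManyOne A C (f ∘ h)
manyOne-∘ {h = h} (ch , A⇔Bh) (cf , B⇔Cf) = computableFun-∘ cf ch , λ x → ⇔-trans (A⇔Bh x) (B⇔Cf (h x))

ComputablySeparable : SetN → SetN → Set₁
ComputablySeparable W A = Σ SetN λ Q → ComputableSet Q × W ⊆ Q × Disjoint Q A

DMaximalCases : SetN → SetN → Set₁
DMaximalCases A Y = CE (Y ∖ A) ⊎ (Σ SetN λ M → ComputableSet M × A ⊆ M × M ⊆ Y)

generates-⊇ : {A W G : SetN} → GeneratesSingleton A W → CE G → Disjoint G A → W ⊆ G → GeneratesSingleton A G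
generates-⊇ (_ , _ , generates) ceG G∩A W⊆G = ceG , G∩A , λ D ceD D∩A →
  finite-⊆ (λ x (Dx , ¬Gx) → Dx , ¬Gx ∘ W⊆G x) (generates D ceD D∩A)

type3-generator-inseparable : {A W : SetN} → ¬ GenType2 A → GeneratesSingleton A W → Infinite W →
                              ¬ ComputablySeparable W A
type3-generator-inseparable notType2 genW infW (Q , cQ , W⊆Q , Q∩A) =
  notType2 (Q , cQ , infinite-⊇ W⊆Q infW , generates-⊇ genW (computable⇒ce cQ) Q∩A W⊆Q)

¬¬separable-by-bounds : {A B W : SetN} {h r : ℕ → ℕ} {n m : ℕ} → ManyOne A B h → ManyOne A A r →
                        Disjoint W A → (∀ x → W x → h x < n ⊎ r x < m) → ¬ ¬ ComputablySeparable W A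
¬¬separable-by-bounds {A} {B} {W} {h} {r} {n} {m} (ch , A⇔Bh) (cr , A⇔Ar) W∩A bounds separable =
  finite⇒¬¬computable {compl B ↾ n} (n , λ _ → proj₁) λ c[B̅↾n] →
  finite⇒¬¬computable {compl A ↾ m} (m , λ _ → proj₁) λ c[A̅↾m] →
  separable (Q , computable-∪ (computable-preimage c[B̅↾n] ch) (computable-preimage c[A̅↾m] cr) , W⊆Q , Q∩A)
  where
  Q : SetN
  Q = preimage h (compl B ↾ n) ∪ preimage r (compl A ↾ m)
  W⊆Q : W ⊆ Q
  W⊆Q x Wx = Sum.map (_, W∩A x Wx ∘ from (A⇔Bh x)) (_, W∩A x Wx ∘ from (A⇔Ar x)) (bounds x Wx)
  Q∩A : Disjoint Q A
  Q∩A x (inj₁ (_ , ¬Bhx)) Ax = ¬Bhx (to (A⇔Bh x) Ax)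
  Q∩A x (inj₂ (_ , ¬Arx)) Ax = ¬Arx (to (A⇔Ar x) Ax)

preimage-infinite : {A B W : SetN} {h f : ℕ → ℕ} → DMaximal A → GeneratesSingleton A W →
                    ¬ ComputablySeparable W A → ManyOne A B h → ManyOne B A f → Infinite (preimage f W)
preimage-infinite {A} {B} {W} {h} {f} (ceA , _ , dmax) (_ , W∩A , generates) inseparable hAB fBA (n , bounded) =
  cases (dmax (A ∪ X) (ce-∪ ceA (ce-rng (computableFun-shift (proj₁ fBA) n))) (λ _ → inj₁))
  where
  X : SetN
  X = rng (λ z → f (n + z))
  X∩W : Disjoint X W
  X∩W _ (z , refl) Wfnz = <⇒≱ (bounded (n + z) Wfnz) (m≤m+n n z)
  fh : ManyOne A A (f ∘ h)
  fh = manyOne-∘ {B = B} {C = A} hAB fBA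
  cases : DMaximalCases A (A ∪ X) → ⊥
  cases (inj₂ (M , cM , A⊆M , M⊆A∪X)) =
    inseparable (compl M , computable-compl cM ,
                 (λ x Wx Mx → [ W∩A x Wx , (λ Xx → X∩W x Xx Wx) ] (M⊆A∪X x Mx)) ,
                 λ x ¬Mx Ax → ¬Mx (A⊆M x Ax))
  cases (inj₁ ce[A∪X∖A]) with generates _ ce[A∪X∖A] (λ _ (_ , ¬Ax) Ax → ¬Ax Ax)
  ... | (m , below-m) = ¬¬separable-by-bounds {B = B} hAB fh W∩A bounds inseparable
    where
    bounds : ∀ x → W x → h x < n ⊎ f (h x) < m
    bounds x Wx = map₂ far (<-≤-connex (h x) n)
      where
      far : n ≤ h x → f (h x) < m
      far n≤hx = below-m (f (h x)) ((inj₂ Xfhx , W∩A x Wx ∘ from (proj₂ fh x)) , X∩W _ Xfhx)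
        where
        Xfhx : X (f (h x))
        Xfhx = h x ∸ n , cong f (m+[n∸m]≡n n≤hx)

compl-∖-rng-finite : {A W : SetN} {h f : ℕ → ℕ} → DMaximal A → GeneratesSingleton A W →
                     ComputableFun f → ManyOne A A (f ∘ h) → Finite (compl A ∖ (rng f ∪ W))
compl-∖-rng-finite {A} {W} {h} {f} (ceA , _ , dmax) (_ , _ , generates) cf (cfh , A⇔Afh) =
  cases (dmax (A ∪ rng f) (ce-∪ ceA (ce-rng cf)) (λ _ → inj₁))
  where
  cases : DMaximalCases A (A ∪ rng f) → Finite (compl A ∖ (rng f ∪ W))
  cases (inj₁ ce[A∪rng∖A]) =
    finite-⊆ (λ x (¬Ax , ∉rng∪W) → (inj₂ (h x , refl) , ¬Ax ∘ from (A⇔Afh x)) , ∉rng∪W ∘ inj₂)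
             (generates _ (ce-preimage ce[A∪rng∖A] cfh) (λ x (_ , ¬Afhx) Ax → ¬Afhx (to (A⇔Afh x) Ax)))
  cases (inj₂ (M , cM , A⊆M , M⊆A∪rng)) =
    finite-⊆ (λ x (¬Ax , ∉rng∪W) → (λ Mx → [ ¬Ax , ∉rng∪W ∘ inj₁ ] (M⊆A∪rng x Mx)) , ∉rng∪W ∘ inj₂)
             (generates _ (computable⇒ce (computable-compl cM)) (λ x ¬Mx Ax → ¬Mx (A⊆M x Ax)))

lemma4p4 : (A : SetN) → CE A → ¬ ComputableSet A → DMaximal A → IsType3 A →
    Σ SetN λ K → CE K × Infinite K × ¬ ComputableSet K × K ⊆ compl A ×
      ((B : SetN) → B ≡m A → (h f : ℕ → ℕ) → ManyOne A B h → ManyOne B A f →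
        Infinite (preimage f K) × Finite (Dh A h ∖ (rng f ∪ K)))
lemma4p4 A _ _ dmax ((W , ceW , infW , ncW , genW@(_ , W∩A , _)) , _ , notType2) =
  W , ceW , infW , ncW , W∩A , λ B _ h f hAB fBA →
    preimage-infinite dmax genW (type3-generator-inseparable notType2 genW infW) hAB fBA ,
    finite-⊆ (λ x (Dhx , ∉rng∪W) → proj₁ Dhx , ∉rng∪W)
             (compl-∖-rng-finite dmax genW (proj₁ fBA) (manyOne-∘ {B = B} {C = A} hAB fBA))
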